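{- Let $\Gamma_1=(V_1,E_1)$ and $\Gamma_2=(V_2,E_2)$ be loopless graphs with $V_1\cap V_2=\emptyset$, $V_1\ne\emptyset\ne V_2$, $n_i=|V_i|$, let $\Gamma=\Gamma_1\vee\Gamma_2$, and let $u\in V_1$. Let $k\ge n_2$. (1) Let $\alpha\in\mathrm{Nil}_k(\Gamma)$ be $u$-centred, let $V_1'=\{v\in V_1:v^\alpha\in V_1\}$, and view $\alpha'=\alpha\restriction V_1'$ as an element of $\mathrm{Nil}(\Gamma_1)$. Then $\mathrm{mon}(\alpha)=X_u^{n_2}\prod_{v\in V_1,\,v^\alpha\in V_2}X_{v^\alpha}\cdot\mathrm{mon}(\alpha')$. (2) Conversely, let $k=n_2+\ell+d\le n_1+n_2-1$ with $\ell,d\ge0$, let $\alpha'\in\mathrm{Nil}_\ell(\Gamma_1)$ and let $m$ be a monomial of degree $d$ in the variables $X_v$, $v\in V_2$. Then there exists a $u$-centred $\alpha\in\mathrm{Nil}_k(\Gamma)$ with $\mathrm{mon}(\alpha)=X_u^{n_2}\,m\cdot\mathrm{mon}(\alpha')$.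
   Context: The join $\Gamma_1\vee\Gamma_2$ is the disjoint union plus all edges between $V_1$ and $V_2$. An animation of a graph $\Gamma=(V,E)$ is a partial function $\alpha:V\dashrightarrow V$ with $v^\alpha\sim v$ for $v\in\mathrm{Dom}(\alpha)$; it is nilpotent if some iterate $\alpha^m$ ($m\ge1$) is nowhere defined; $\mathrm{Nil}_k$ denotes nilpotent animations of degree $|\mathrm{Dom}(\alpha)|=k$; $\mathrm{mon}(\alpha)=\prod_{v\in\mathrm{Dom}(\alpha)}X_{v^\alpha}$. $\alpha\restriction V_1'$ is the partial function agreeing with $\alpha$ on $V_1'$ and undefined elsewhere. For $u\in V_1$, $\alpha\in\mathrm{Nil}_k(\Gamma)$ is $u$-centred if $|V_2\cap\mathrm{Dom}(\alpha)|=\min(k,n_2)$ and $v^\alpha=u$ for all $v\in V_2\cap\mathrm{Dom}(\alpha)$. -}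

module Defs where

open import Data.Nat using (ℕ; zero; suc; _+_; _⊓_)
open import Data.Bool using (Bool; true; false; if_then_else_)
open import Data.Fin using (Fin; zero; suc; _↑ˡ_; _↑ʳ_; splitAt; _≟_)
open import Data.Maybe using (Maybe; just; nothing; is-just; _>>=_)
open import Data.Sum using (inj₁; inj₂)
open import Data.Product using (Σ; _×_)
open import Relation.Nullary.Decidable using (⌊_⌋)
open import Relation.Binary.PropositionalEquality using (_≡_)

Adj : ℕ → Set
Adj n = Fin n → Fin n → Bool

IsLoopless : ∀ {n} → Adj n → Set
IsLoopless {n} adj = (∀ (v w : Fin n) → adj v w ≡ adj w v) × (∀ (v : Fin n) → adj v v ≡ false)

-- The join Γ₁ ∨ Γ₂ on Fin (n₁ + n₂): V₁ = Fin n₁ embedded via _↑ˡ n₂, V₂ via n₁ ↑ʳ_.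
join : ∀ {n₁ n₂} → Adj n₁ → Adj n₂ → Adj (n₁ + n₂)
join {n₁} a₁ a₂ v w with splitAt n₁ v | splitAt n₁ w
... | inj₁ x | inj₁ y = a₁ x y
... | inj₂ x | inj₂ y = a₂ x y
... | inj₁ _ | inj₂ _ = true
... | inj₂ _ | inj₁ _ = true

PFun : ℕ → Set
PFun n = Fin n → Maybe (Fin n)

IsAnimation : ∀ {n} → Adj n → PFun n → Set
IsAnimation {n} adj α = ∀ (v w : Fin n) → α v ≡ just w → adj v w ≡ true

iter : ∀ {n} → PFun n → ℕ → PFun n
iter α zero v = just v
iter α (suc m) v = iter α m v >>= α

IsNilpotent : ∀ {n} → PFun n → Set
IsNilpotent {n} α = Σ ℕ (λ m → ∀ (v : Fin n) → iter α (suc m) v ≡ nothing)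

sumF : ∀ {n} → (Fin n → ℕ) → ℕ
sumF {zero} f = 0
sumF {suc n} f = f zero + sumF (λ i → f (suc i))

count : ∀ {n} → (Fin n → Bool) → ℕ
count p = sumF (λ i → if p i then 1 else 0)

degree : ∀ {n} → PFun n → ℕ
degree α = count (λ v → is-just (α v))

Nil : ∀ {n} → Adj n → ℕ → PFun n → Set
Nil adj k α = IsAnimation adj α × IsNilpotent α × degree α ≡ k

-- Monomials in variables X_v (v : Fin n) as exponent vectors.
Mono : ℕ → Set
Mono n = Fin n → ℕ

_⊗_ : ∀ {n} → Mono n → Mono n → Mono n
(m ⊗ m') v = m v + m' v
infixl 7 _⊗_

_≐_ : ∀ {n} → Mono n → Mono n → Set
_≐_ {n} m m' = ∀ (v : Fin n) → m v ≡ m' v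
infix 4 _≐_

mdegree : ∀ {n} → Mono n → ℕ
mdegree = sumF

varPow : ∀ {n} → Fin n → ℕ → Mono n
varPow w e v = if ⌊ v ≟ w ⌋ then e else 0

hits : ∀ {n} → Maybe (Fin n) → Fin n → Bool
hits nothing w = false
hits (just x) w = ⌊ x ≟ w ⌋

mon : ∀ {n} → PFun n → Mono n
mon α w = count (λ v → hits (α v) w)

embed₁ : ∀ {n₁ n₂} → Mono n₁ → Mono (n₁ + n₂)
embed₁ {n₁} m w with splitAt n₁ w
... | inj₁ x = m x
... | inj₂ _ = 0

embed₂ : ∀ {n₁ n₂} → Mono n₂ → Mono (n₁ + n₂)
embed₂ {n₁} m w with splitAt n₁ w
... | inj₁ _ = 0
... | inj₂ y = m y

UCentred : ∀ {n₁ n₂} → Fin n₁ → ℕ → PFun (n₁ + n₂) → Set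
UCentred {n₁} {n₂} u k α =
  (count (λ j → is-just (α (n₁ ↑ʳ j))) ≡ k ⊓ n₂)
  × (∀ (j : Fin n₂) (w : Fin (n₁ + n₂)) → α (n₁ ↑ʳ j) ≡ just w → w ≡ u ↑ˡ n₂)

restrict₁ : ∀ {n₁ n₂} → PFun (n₁ + n₂) → PFun n₁
restrict₁ {n₁} {n₂} α v with α (v ↑ˡ n₂)
... | nothing = nothing
... | just w with splitAt n₁ w
...   | inj₁ x = just x
...   | inj₂ _ = nothing

crossMon : ∀ {n₁ n₂} → PFun (n₁ + n₂) → Mono (n₁ + n₂)
crossMon {n₁} {n₂} α = embed₂ {n₁} (λ j → count (λ v → hits (α (v ↑ˡ n₂)) (n₁ ↑ʳ j)))

-- Since k ≥ n₂, a u-centred α sends all of V₂ to u, which contributes X_u^n₂; the vertices of V₁ sent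
-- into V₁ form an animation of Γ₁ whose orbits are orbits of α, hence nilpotent, and those sent into V₂
-- contribute the remaining factor. Conversely, extend α′ by sending V₂ to u and sending d of the
-- n₁ − ℓ vertices outside Dom α′ into V₂, each X_y being hit as often as its exponent in m. The bound
-- k ≤ n₁ + n₂ − 1 leaves one vertex outside Dom α′ unused; choosing it to be the end t of the α′-orbit
-- of u makes every orbit V₂ → u → ⋯ → t terminate.
module Submission where

open import Defs
open import Data.Nat using (ℕ; zero; suc; _+_; _∸_; _≤_; _<_; z≤n; s≤s; s≤s⁻¹)
open import Data.Nat.Properties
  using (+-comm; +-assoc; +-suc; +-identityʳ; suc-injective; m≤n⇒m≤1+n; <⇒≱; n<1+n;
         m∸n+n≡m; m≤m+n; m≤n+m; +-monoˡ-≤; ≤-trans; m≥n⇒m⊓n≡n; +-cancelˡ-≤; m+n≡0⇒m≡0; m+n≡0⇒n≡0)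
open import Data.Fin using (Fin; zero; suc; _↑ˡ_; _↑ʳ_; splitAt; _≟_)
open import Data.Fin.Properties
  using (splitAt-↑ˡ; splitAt-↑ʳ; splitAt⁻¹-↑ˡ; splitAt⁻¹-↑ʳ; ↑ˡ-injective; ↑ʳ-injective)
  renaming (suc-injective to fsuc-injective)
open import Data.Bool using (Bool; true; false; if_then_else_; not; _∧_)
open import Data.Bool.Properties using (∧-identityʳ; ∧-zeroʳ)
open import Data.Maybe using (Maybe; just; nothing; is-just; _>>=_)
open import Data.Maybe.Properties using (just-injective)
open import Data.Sum using (inj₁; inj₂; [_,_]′)
open import Data.Product using (Σ; ∃-syntax; _×_; _,_)
open import Data.Empty using (⊥-elim)
open import Function using (_∘_)
open import Function.Definitions using (Injective)
open import Relation.Nullary using (¬_; yes; no)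
open import Relation.Nullary.Decidable using (⌊_⌋)
open import Relation.Binary.PropositionalEquality
open import Data.Nat.Tactic.RingSolver using (solve-∀)

open ≡-Reasoning

indicator : Bool → ℕ
indicator b = if b then 1 else 0

sumF-cong : ∀ {n} {f g : Fin n → ℕ} → (∀ i → f i ≡ g i) → sumF f ≡ sumF g
sumF-cong {zero} f≗g = refl
sumF-cong {suc n} f≗g = cong₂ _+_ (f≗g zero) (sumF-cong (f≗g ∘ suc))

sumF-+ : ∀ {n} (f g : Fin n → ℕ) → sumF (λ i → f i + g i) ≡ sumF f + sumF g
sumF-+ {zero} f g = refl
sumF-+ {suc n} f g = begin
  f zero + g zero + sumF (λ i → f (suc i) + g (suc i))
    ≡⟨ cong (f zero + g zero +_) (sumF-+ (f ∘ suc) (g ∘ suc)) ⟩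
  f zero + g zero + (sumF (f ∘ suc) + sumF (g ∘ suc))
    ≡⟨ interchange (f zero) (g zero) _ _ ⟩
  f zero + sumF (f ∘ suc) + (g zero + sumF (g ∘ suc)) ∎
  where
  interchange : ∀ a b c d → a + b + (c + d) ≡ a + c + (b + d)
  interchange = solve-∀

sumF-↑ : ∀ n₁ {n₂} (f : Fin (n₁ + n₂) → ℕ) → sumF f ≡ sumF (λ i → f (i ↑ˡ n₂)) + sumF (λ j → f (n₁ ↑ʳ j))
sumF-↑ zero f = refl
sumF-↑ (suc n₁) f = trans (cong (f zero +_) (sumF-↑ n₁ (f ∘ suc))) (sym (+-assoc (f zero) _ _))

sumF≡0⇒≡0 : ∀ {n} (f : Fin n → ℕ) → sumF f ≡ 0 → ∀ i → f i ≡ 0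
sumF≡0⇒≡0 {suc n} f e zero = m+n≡0⇒m≡0 (f zero) e
sumF≡0⇒≡0 {suc n} f e (suc i) = sumF≡0⇒≡0 (f ∘ suc) (m+n≡0⇒n≡0 (f zero) e) i

count-cong : ∀ {n} {p q : Fin n → Bool} → (∀ i → p i ≡ q i) → count p ≡ count q
count-cong p≗q = sumF-cong (cong indicator ∘ p≗q)

count-const : ∀ n b → count {n} (λ _ → b) ≡ (if b then n else 0)
count-const zero true = refl
count-const zero false = refl
count-const (suc n) true = cong suc (count-const n true)
count-const (suc n) false = count-const n false

count≤n : ∀ {n} (p : Fin n → Bool) → count p ≤ n
count≤n {zero} p = z≤n
count≤n {suc n} p with p zero
... | true = s≤s (count≤n (p ∘ suc))
... | false = m≤n⇒m≤1+n (count≤n (p ∘ suc))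

count≡n⇒all : ∀ {n} (p : Fin n → Bool) → count p ≡ n → ∀ i → p i ≡ true
count≡n⇒all {suc n} p e i with p zero in p0
count≡n⇒all {suc n} p e zero | true = p0
count≡n⇒all {suc n} p e (suc i) | true = count≡n⇒all (p ∘ suc) (suc-injective e) i
... | false = ⊥-elim (<⇒≱ (n<1+n n) (subst (_≤ n) e (count≤n (p ∘ suc))))

count+count-not : ∀ {n} (p : Fin n → Bool) → count p + count (not ∘ p) ≡ n
count+count-not {zero} p = refl
count+count-not {suc n} p with p zero
... | true = cong suc (count+count-not (p ∘ suc))
... | false = trans (+-suc _ _) (cong suc (count+count-not (p ∘ suc)))

⌊≟⌋-true : ∀ {n} {a b : Fin n} → a ≡ b → ⌊ a ≟ b ⌋ ≡ true
⌊≟⌋-true {a = a} {b} a≡b with a ≟ b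
... | yes _ = refl
... | no a≢b = ⊥-elim (a≢b a≡b)

⌊≟⌋-false : ∀ {n} {a b : Fin n} → ¬ a ≡ b → ⌊ a ≟ b ⌋ ≡ false
⌊≟⌋-false {a = a} {b} a≢b with a ≟ b
... | yes a≡b = ⊥-elim (a≢b a≡b)
... | no _ = refl

⌊≟⌋-sym : ∀ {n} (a b : Fin n) → ⌊ a ≟ b ⌋ ≡ ⌊ b ≟ a ⌋
⌊≟⌋-sym a b with a ≟ b
... | yes a≡b = sym (⌊≟⌋-true (sym a≡b))
... | no a≢b = sym (⌊≟⌋-false (a≢b ∘ sym))

⌊≟⌋-injective : ∀ {m n} (f : Fin m → Fin n) → Injective _≡_ _≡_ f → ∀ a b → ⌊ f a ≟ f b ⌋ ≡ ⌊ a ≟ b ⌋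
⌊≟⌋-injective f f-inj a b with a ≟ b
... | yes a≡b = ⌊≟⌋-true (cong f a≡b)
... | no a≢b = ⌊≟⌋-false (a≢b ∘ f-inj)

count-remove : ∀ {n} (p : Fin n → Bool) t → p t ≡ true → count p ≡ suc (count (λ v → p v ∧ not ⌊ v ≟ t ⌋))
count-remove {suc n} p zero pt rewrite pt = cong suc (count-cong (sym ∘ ∧-identityʳ ∘ p ∘ suc))
count-remove {suc n} p (suc t) pt rewrite count-remove (p ∘ suc) t pt | ∧-identityʳ (p zero) =
  trans (+-suc _ _) (cong (λ c → suc (indicator (p zero) + c))
    (count-cong (λ v → cong (λ b → p (suc v) ∧ not b) (sym (⌊≟⌋-injective suc fsuc-injective v t)))))

data View (n₁ n₂ : ℕ) : Fin (n₁ + n₂) → Set where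
  left : ∀ x → View n₁ n₂ (x ↑ˡ n₂)
  right : ∀ y → View n₁ n₂ (n₁ ↑ʳ y)

view : ∀ n₁ n₂ (w : Fin (n₁ + n₂)) → View n₁ n₂ w
view n₁ n₂ w with splitAt n₁ w in e
... | inj₁ x = subst (View n₁ n₂) (splitAt⁻¹-↑ˡ e) (left x)
... | inj₂ y = subst (View n₁ n₂) (splitAt⁻¹-↑ʳ e) (right y)

↑ˡ≢↑ʳ : ∀ {n₁ n₂} (x : Fin n₁) (y : Fin n₂) → ¬ x ↑ˡ n₂ ≡ n₁ ↑ʳ y
↑ˡ≢↑ʳ {n₁} {n₂} x y e with trans (sym (splitAt-↑ˡ n₁ x n₂)) (trans (cong (splitAt n₁) e) (splitAt-↑ʳ n₁ n₂ y))
... | ()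

⌊↑ˡ≟↑ʳ⌋ : ∀ {n₁ n₂} (x : Fin n₁) (y : Fin n₂) → ⌊ x ↑ˡ n₂ ≟ n₁ ↑ʳ y ⌋ ≡ false
⌊↑ˡ≟↑ʳ⌋ x y = ⌊≟⌋-false (↑ˡ≢↑ʳ x y)

⌊↑ʳ≟↑ˡ⌋ : ∀ {n₁ n₂} (y : Fin n₂) (x : Fin n₁) → ⌊ n₁ ↑ʳ y ≟ x ↑ˡ n₂ ⌋ ≡ false
⌊↑ʳ≟↑ˡ⌋ y x = ⌊≟⌋-false (↑ˡ≢↑ʳ x y ∘ sym)

≐-by-view : ∀ {n₁ n₂} {m m′ : Mono (n₁ + n₂)}
  → (∀ x → m (x ↑ˡ n₂) ≡ m′ (x ↑ˡ n₂)) → (∀ y → m (n₁ ↑ʳ y) ≡ m′ (n₁ ↑ʳ y)) → m ≐ m′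
≐-by-view {n₁} {n₂} onV₁ onV₂ w with view n₁ n₂ w
... | left x = onV₁ x
... | right y = onV₂ y

join-↑ˡ-↑ˡ : ∀ {n₁ n₂} (Γ₁ : Adj n₁) (Γ₂ : Adj n₂) x y → join Γ₁ Γ₂ (x ↑ˡ n₂) (y ↑ˡ n₂) ≡ Γ₁ x y
join-↑ˡ-↑ˡ {n₁} {n₂} Γ₁ Γ₂ x y rewrite splitAt-↑ˡ n₁ x n₂ | splitAt-↑ˡ n₁ y n₂ = refl

join-↑ˡ-↑ʳ : ∀ {n₁ n₂} (Γ₁ : Adj n₁) (Γ₂ : Adj n₂) x y → join Γ₁ Γ₂ (x ↑ˡ n₂) (n₁ ↑ʳ y) ≡ true
join-↑ˡ-↑ʳ {n₁} {n₂} Γ₁ Γ₂ x y rewrite splitAt-↑ˡ n₁ x n₂ | splitAt-↑ʳ n₁ n₂ y = refl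

join-↑ʳ-↑ˡ : ∀ {n₁ n₂} (Γ₁ : Adj n₁) (Γ₂ : Adj n₂) y x → join Γ₁ Γ₂ (n₁ ↑ʳ y) (x ↑ˡ n₂) ≡ true
join-↑ʳ-↑ˡ {n₁} {n₂} Γ₁ Γ₂ y x rewrite splitAt-↑ˡ n₁ x n₂ | splitAt-↑ʳ n₁ n₂ y = refl

embed₁-↑ˡ : ∀ {n₁ n₂} (m : Mono n₁) x → embed₁ {n₁} {n₂} m (x ↑ˡ n₂) ≡ m x
embed₁-↑ˡ {n₁} {n₂} m x rewrite splitAt-↑ˡ n₁ x n₂ = refl

embed₁-↑ʳ : ∀ {n₁ n₂} (m : Mono n₁) y → embed₁ {n₁} {n₂} m (n₁ ↑ʳ y) ≡ 0
embed₁-↑ʳ {n₁} {n₂} m y rewrite splitAt-↑ʳ n₁ n₂ y = refl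

embed₂-↑ˡ : ∀ {n₁ n₂} (m : Mono n₂) x → embed₂ {n₁} {n₂} m (x ↑ˡ n₂) ≡ 0
embed₂-↑ˡ {n₁} {n₂} m x rewrite splitAt-↑ˡ n₁ x n₂ = refl

embed₂-↑ʳ : ∀ {n₁ n₂} (m : Mono n₂) y → embed₂ {n₁} {n₂} m (n₁ ↑ʳ y) ≡ m y
embed₂-↑ʳ {n₁} {n₂} m y rewrite splitAt-↑ʳ n₁ n₂ y = refl

monˡ : ∀ {n₁ n₂} → PFun (n₁ + n₂) → Mono (n₁ + n₂)
monˡ {n₁} {n₂} α w = count (λ v → hits (α (v ↑ˡ n₂)) w)

mon-centred : ∀ {n₁ n₂} {α : PFun (n₁ + n₂)} {x : Fin (n₁ + n₂)} {a b : Mono (n₁ + n₂)}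
  → (∀ j → α (n₁ ↑ʳ j) ≡ just x) → monˡ {n₁} {n₂} α ≐ a ⊗ b → mon α ≐ varPow x n₂ ⊗ a ⊗ b
mon-centred {n₁} {n₂} {α} {x} {a} {b} V₂↦x monˡ≐ w = begin
  mon α w
    ≡⟨ sumF-↑ n₁ _ ⟩
  monˡ {n₁} {n₂} α w + count (λ j → hits (α (n₁ ↑ʳ j)) w)
    ≡⟨ cong₂ _+_ (monˡ≐ w) (count-cong (λ j → cong (λ z → hits z w) (V₂↦x j))) ⟩
  a w + b w + count {n₂} (λ _ → ⌊ x ≟ w ⌋)
    ≡⟨ cong (a w + b w +_) (trans (count-const n₂ _) (cong (if_then n₂ else 0) (⌊≟⌋-sym x w))) ⟩
  a w + b w + varPow x n₂ w
    ≡⟨ +-comm (a w + b w) _ ⟩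
  varPow x n₂ w + (a w + b w)
    ≡⟨ sym (+-assoc (varPow x n₂ w) _ _) ⟩
  varPow x n₂ w + a w + b w ∎

centred⇒V₂↦u : ∀ {n₁ n₂} {u : Fin n₁} {k} {α : PFun (n₁ + n₂)} → n₂ ≤ k → UCentred u k α
  → ∀ j → α (n₁ ↑ʳ j) ≡ just (u ↑ˡ n₂)
centred⇒V₂↦u {n₁} {n₂} {α = α} n₂≤k (size , ↦u) j
  with α (n₁ ↑ʳ j) in e | count≡n⇒all _ (trans size (m≥n⇒m⊓n≡n n₂≤k)) j
... | just w | _ = cong just (↦u j w e)

V₂↦u⇒centred : ∀ {n₁ n₂} {u : Fin n₁} {k} {α : PFun (n₁ + n₂)} → n₂ ≤ k
  → (∀ j → α (n₁ ↑ʳ j) ≡ just (u ↑ˡ n₂)) → UCentred u k α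
V₂↦u⇒centred {n₁} {n₂} {k = k} n₂≤k V₂↦u =
  trans (count-cong (cong is-just ∘ V₂↦u)) (trans (count-const n₂ true) (sym (m≥n⇒m⊓n≡n n₂≤k))) ,
  λ j w e → just-injective (trans (sym e) (V₂↦u j))

iter-suc′ : ∀ {n} (α : PFun n) j v → iter α (suc j) v ≡ (α v >>= iter α j)
iter-suc′ α zero v with α v
... | nothing = refl
... | just _ = refl
iter-suc′ α (suc j) v rewrite iter-suc′ α j v with α v
... | nothing = refl
... | just _ = refl

iter-+ : ∀ {n} (α : PFun n) a b {v w} → iter α a v ≡ just w → iter α (a + b) v ≡ iter α b w
iter-+ α zero b refl = refl
iter-+ α (suc a) b {v} e rewrite iter-suc′ α (a + b) v | iter-suc′ α a v with α v
... | just x = iter-+ α a b e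

iter-nothing-mono : ∀ {n} (α : PFun n) {a b v} → a ≤ b → iter α a v ≡ nothing → iter α b v ≡ nothing
iter-nothing-mono α {a} {b} {v} a≤b e = subst (λ c → iter α c v ≡ nothing) (m∸n+n≡m a≤b) (after (b ∸ a))
  where
  after : ∀ c → iter α (c + a) v ≡ nothing
  after zero = e
  after (suc c) rewrite after c = refl

nilpotent-if-bounded : ∀ {n} (α : PFun n) K → (∀ v → ∃[ a ] a ≤ K × iter α a v ≡ nothing) → IsNilpotent α
nilpotent-if-bounded α K bounded = K , λ v → let (a , a≤K , e) = bounded v in iter-nothing-mono α (m≤n⇒m≤1+n a≤K) e

reaches-sink : ∀ {n} (α : PFun n) f v → iter α f v ≡ nothing
  → ∃[ j ] ∃[ t ] j < f × iter α j v ≡ just t × α t ≡ nothing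
reaches-sink α (suc f) v e with α v in αv
... | nothing = zero , v , s≤s z≤n , refl , αv
... | just w with reaches-sink α f w (trans (sym (trans (iter-suc′ α f v) (cong (_>>= iter α f) αv))) e)
...   | j , t , j<f , w↦t , t-sink = suc j , t , s≤s j<f , trans (iter-suc′ α j v) (trans (cong (_>>= iter α j) αv) w↦t) , t-sink

iter-simulate : ∀ {m n} (α : PFun m) (β : PFun n) (h : Fin m → Fin n)
  → (∀ x y → α x ≡ just y → β (h x) ≡ just (h y))
  → ∀ j {v t} → iter α j v ≡ just t → iter β j (h v) ≡ just (h t)
iter-simulate α β h sim zero refl = refl
iter-simulate α β h sim (suc j) {v} e with iter α j v in αʲv
... | just x rewrite iter-simulate α β h sim j αʲv = sim x _ e

nilpotent-simulate : ∀ {m n} (α : PFun m) (β : PFun n) (h : Fin m → Fin n)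
  → (∀ x y → α x ≡ just y → β (h x) ≡ just (h y)) → IsNilpotent β → IsNilpotent α
nilpotent-simulate α β h sim (M , β-nil) = M , α-nil
  where
  α-nil : ∀ v → iter α (suc M) v ≡ nothing
  α-nil v with iter α (suc M) v in e
  ... | nothing = refl
  ... | just t with trans (sym (iter-simulate α β h sim (suc M) e)) (β-nil (h v))
  ...   | ()

restrict₁-just : ∀ {n₁ n₂} (α : PFun (n₁ + n₂)) v x
  → restrict₁ {n₁} {n₂} α v ≡ just x → α (v ↑ˡ n₂) ≡ just (x ↑ˡ n₂)
restrict₁-just {n₁} {n₂} α v x e with α (v ↑ˡ n₂)
... | just w with splitAt n₁ w in s
...   | inj₁ y with refl ← e = cong just (sym (splitAt⁻¹-↑ˡ s))

hits-restrict₁ : ∀ {n₁ n₂} (α : PFun (n₁ + n₂)) v x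
  → hits (α (v ↑ˡ n₂)) (x ↑ˡ n₂) ≡ hits (restrict₁ {n₁} {n₂} α v) x
hits-restrict₁ {n₁} {n₂} α v x with α (v ↑ˡ n₂)
... | nothing = refl
... | just w with splitAt n₁ w in s
...   | inj₁ y = trans (cong (λ z → ⌊ z ≟ x ↑ˡ n₂ ⌋) (sym (splitAt⁻¹-↑ˡ s))) (⌊≟⌋-injective (_↑ˡ n₂) (↑ˡ-injective n₂ _ _) y x)
...   | inj₂ z = trans (cong (λ z → ⌊ z ≟ x ↑ˡ n₂ ⌋) (sym (splitAt⁻¹-↑ʳ s))) (⌊↑ʳ≟↑ˡ⌋ z x)

restrict₁-Nil : ∀ {n₁ n₂} (Γ₁ : Adj n₁) (Γ₂ : Adj n₂) {k} (α : PFun (n₁ + n₂))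
  → Nil (join Γ₁ Γ₂) k α → Nil Γ₁ (degree (restrict₁ {n₁} {n₂} α)) (restrict₁ {n₁} {n₂} α)
restrict₁-Nil {n₁} {n₂} Γ₁ Γ₂ α (animation , nilpotent , _) =
  (λ v x e → trans (sym (join-↑ˡ-↑ˡ Γ₁ Γ₂ v x)) (animation _ _ (restrict₁-just α v x e))) ,
  nilpotent-simulate (restrict₁ α) α (_↑ˡ n₂) (restrict₁-just α) nilpotent ,
  refl

monˡ-restrict₁ : ∀ {n₁ n₂} (α : PFun (n₁ + n₂))
  → monˡ {n₁} {n₂} α ≐ crossMon {n₁} {n₂} α ⊗ embed₁ {n₁} {n₂} (mon (restrict₁ {n₁} {n₂} α))
monˡ-restrict₁ {n₁} {n₂} α = ≐-by-view onV₁ onV₂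
  where
  onV₁ : ∀ x → monˡ {n₁} {n₂} α (x ↑ˡ n₂) ≡ crossMon {n₁} {n₂} α (x ↑ˡ n₂) + embed₁ {n₁} {n₂} (mon (restrict₁ α)) (x ↑ˡ n₂)
  onV₁ x = trans (count-cong (λ v → hits-restrict₁ α v x)) (sym (cong₂ _+_ (embed₂-↑ˡ {n₁} _ x) (embed₁-↑ˡ {n₁} _ x)))
  onV₂ : ∀ y → monˡ {n₁} {n₂} α (n₁ ↑ʳ y) ≡ crossMon {n₁} {n₂} α (n₁ ↑ʳ y) + embed₁ {n₁} {n₂} (mon (restrict₁ α)) (n₁ ↑ʳ y)
  onV₂ y = sym (trans (cong₂ _+_ (embed₂-↑ʳ {n₁} _ y) (embed₁-↑ʳ {n₁} {n₂} _ y)) (+-identityʳ _))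

peel-variable : ∀ {n} (m : Mono n) {d} → mdegree m ≡ suc d
  → ∃[ y ] ∃[ m′ ] (m ≐ varPow y 1 ⊗ m′) × mdegree m′ ≡ d
peel-variable {suc n} m e with m zero in m₀
... | suc a = zero , m′ , split , suc-injective e
  where
  m′ : Mono (suc n)
  m′ zero = a
  m′ (suc i) = m (suc i)
  split : m ≐ varPow zero 1 ⊗ m′
  split zero = m₀
  split (suc i) = refl
... | zero with peel-variable (m ∘ suc) e
...   | y , m′ , split , deg = suc y , m″ , split′ , deg
  where
  m″ : Mono (suc n)
  m″ zero = 0
  m″ (suc i) = m′ i
  split′ : m ≐ varPow (suc y) 1 ⊗ m″
  split′ zero = m₀
  split′ (suc i) = trans (split i) (cong (λ b → (if b then 1 else 0) + m′ i) (sym (⌊≟⌋-injective suc fsuc-injective i y)))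

record Realisation {n n₂} (P : Fin n → Bool) (m : Mono n₂) : Set where
  field
    choice : Fin n → Maybe (Fin n₂)
    choice⇒P : ∀ v y → choice v ≡ just y → P v ≡ true
    hits-choice : ∀ y → count (λ v → hits (choice v) y) ≡ m y
    size-choice : count (λ v → is-just (choice v)) ≡ mdegree m

realise : ∀ {n n₂} (P : Fin n → Bool) (m : Mono n₂) → mdegree m ≤ count P → Realisation P m
realise {n} P m deg≤ with mdegree m in deg
... | zero = record
  { choice = λ _ → nothing
  ; choice⇒P = λ _ _ ()
  ; hits-choice = λ y → trans (count-const n false) (sym (sumF≡0⇒≡0 m deg y))
  ; size-choice = trans (count-const n false) (sym deg)
  }
realise {suc n} P m deg≤ | suc d with P zero in P₀ | peel-variable m deg
... | false | _ = record
  { choice = λ { zero → nothing ; (suc v) → choice v }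
  ; choice⇒P = λ { zero _ () ; (suc v) → choice⇒P v }
  ; hits-choice = hits-choice
  ; size-choice = size-choice
  }
  where open Realisation (realise (P ∘ suc) m (subst (_≤ count (P ∘ suc)) (sym deg) deg≤))
... | true | y₀ , m′ , split , deg′ = record
  { choice = λ { zero → just y₀ ; (suc v) → choice v }
  ; choice⇒P = λ { zero _ _ → P₀ ; (suc v) → choice⇒P v }
  ; hits-choice = λ y → trans (cong₂ _+_ (cong indicator (⌊≟⌋-sym y₀ y)) (hits-choice y)) (sym (split y))
  ; size-choice = trans (cong suc (trans size-choice deg′)) (sym deg)
  }
  where open Realisation (realise (P ∘ suc) m′ (subst (_≤ count (P ∘ suc)) (sym deg′) (s≤s⁻¹ deg≤)))

module Extension {n₁ n₂} (u : Fin n₁) (α′ : PFun n₁) (g : Fin n₁ → Maybe (Fin n₂)) where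

  target : Maybe (Fin n₂) → Maybe (Fin n₁) → Maybe (Fin (n₁ + n₂))
  target (just y) _ = just (n₁ ↑ʳ y)
  target nothing (just x) = just (x ↑ˡ n₂)
  target nothing nothing = nothing

  extend : PFun (n₁ + n₂)
  extend w = [ (λ v → target (g v) (α′ v)) , (λ _ → just (u ↑ˡ n₂)) ]′ (splitAt n₁ w)

  extend-↑ˡ : ∀ v → extend (v ↑ˡ n₂) ≡ target (g v) (α′ v)
  extend-↑ˡ v = cong [ (λ v → target (g v) (α′ v)) , (λ _ → just (u ↑ˡ n₂)) ]′ (splitAt-↑ˡ n₁ v n₂)

  extend-↑ʳ : ∀ j → extend (n₁ ↑ʳ j) ≡ just (u ↑ˡ n₂)
  extend-↑ʳ j = cong [ (λ v → target (g v) (α′ v)) , (λ _ → just (u ↑ˡ n₂)) ]′ (splitAt-↑ʳ n₁ n₂ j)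

  Disjoint : Set
  Disjoint = ∀ v y → g v ≡ just y → α′ v ≡ nothing

  extend-animation : (Γ₁ : Adj n₁) (Γ₂ : Adj n₂) → IsAnimation Γ₁ α′ → IsAnimation (join Γ₁ Γ₂) extend
  extend-animation Γ₁ Γ₂ animation′ w z e with view n₁ n₂ w
  ... | right j with refl ← trans (sym (extend-↑ʳ j)) e = join-↑ʳ-↑ˡ Γ₁ Γ₂ j u
  ... | left v = onV₁ (g v) (α′ v) refl (trans (sym (extend-↑ˡ v)) e)
    where
    onV₁ : ∀ a b → b ≡ α′ v → target a b ≡ just z → join Γ₁ Γ₂ (v ↑ˡ n₂) z ≡ true
    onV₁ (just y) b _ refl = join-↑ˡ-↑ʳ Γ₁ Γ₂ v y
    onV₁ nothing (just x) α′v refl = trans (join-↑ˡ-↑ˡ Γ₁ Γ₂ v x) (animation′ v x (sym α′v))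

  extend-simulates : Disjoint → ∀ x y → α′ x ≡ just y → extend (x ↑ˡ n₂) ≡ just (y ↑ˡ n₂)
  extend-simulates disjoint x y α′x rewrite extend-↑ˡ x with g x in gx
  ... | just y′ with () ← trans (sym α′x) (disjoint x y′ gx)
  ... | nothing rewrite α′x = refl

  -- Every orbit from V₂ runs through u to the sink t of u, which g leaves undefined; any other orbit
  -- either dies in V₁ or enters V₂.
  extend-nilpotent : Disjoint → ∀ {M j t} → (∀ v → iter α′ (suc M) v ≡ nothing)
    → iter α′ j u ≡ just t → α′ t ≡ nothing → g t ≡ nothing → IsNilpotent extend
  extend-nilpotent disjoint {M} {j} {t} α′-nil u↦t t-sink gt = nilpotent-if-bounded extend (suc M + suc (suc j)) bound
    where
    sink-step : ∀ i {v s} → iter α′ i v ≡ just s → α′ s ≡ nothing → iter extend (suc i) (v ↑ˡ n₂) ≡ target (g s) nothing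
    sink-step i {v} {s} v↦s s-sink = begin
      (iter extend i (v ↑ˡ n₂) >>= extend)
        ≡⟨ cong (_>>= extend) (iter-simulate α′ extend (_↑ˡ n₂) (extend-simulates disjoint) i v↦s) ⟩
      extend (s ↑ˡ n₂)          ≡⟨ extend-↑ˡ s ⟩
      target (g s) (α′ s)       ≡⟨ cong (target (g s)) s-sink ⟩
      target (g s) nothing      ∎
    fromV₂ : ∀ y → iter extend (suc (suc j)) (n₁ ↑ʳ y) ≡ nothing
    fromV₂ y = begin
      iter extend (suc (suc j)) (n₁ ↑ʳ y)         ≡⟨ iter-suc′ extend (suc j) _ ⟩
      (extend (n₁ ↑ʳ y) >>= iter extend (suc j))  ≡⟨ cong (_>>= iter extend (suc j)) (extend-↑ʳ y) ⟩
      iter extend (suc j) (u ↑ˡ n₂)               ≡⟨ sink-step j u↦t t-sink ⟩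
      target (g t) nothing                        ≡⟨ cong (λ a → target a nothing) gt ⟩
      nothing                                     ∎
    bound : ∀ w → ∃[ a ] a ≤ suc M + suc (suc j) × iter extend a w ≡ nothing
    bound w with view n₁ n₂ w
    ... | right y = suc (suc j) , m≤n+m (suc (suc j)) (suc M) , fromV₂ y
    ... | left v with reaches-sink α′ (suc M) v (α′-nil v)
    ...   | i , s , i<1+M , v↦s , s-sink with g s | sink-step i v↦s s-sink
    ...     | nothing | e = suc i , ≤-trans i<1+M (m≤m+n _ _) , e
    ...     | just y | e = suc i + suc (suc j) , +-monoˡ-≤ (suc (suc j)) i<1+M , trans (iter-+ extend (suc i) _ e) (fromV₂ y)

  indicator-target : ∀ a b → (∀ y → a ≡ just y → b ≡ nothing)
    → indicator (is-just (target a b)) ≡ indicator (is-just a) + indicator (is-just b)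
  indicator-target (just y) b disjoint rewrite disjoint y refl = refl
  indicator-target nothing (just x) _ = refl
  indicator-target nothing nothing _ = refl

  degree-extend : Disjoint → degree extend ≡ count (λ v → is-just (g v)) + degree α′ + n₂
  degree-extend disjoint = begin
    degree extend
      ≡⟨ sumF-↑ n₁ _ ⟩
    count (λ v → is-just (extend (v ↑ˡ n₂))) + count (λ j → is-just (extend (n₁ ↑ʳ j)))
      ≡⟨ cong₂ _+_ (sumF-cong onV₁) (count-cong (cong is-just ∘ extend-↑ʳ)) ⟩
    sumF (λ v → indicator (is-just (g v)) + indicator (is-just (α′ v))) + count {n₂} (λ _ → true)
      ≡⟨ cong₂ _+_ (sumF-+ (indicator ∘ is-just ∘ g) (indicator ∘ is-just ∘ α′)) (count-const n₂ true) ⟩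
    count (λ v → is-just (g v)) + degree α′ + n₂ ∎
    where
    onV₁ : ∀ v → indicator (is-just (extend (v ↑ˡ n₂))) ≡ indicator (is-just (g v)) + indicator (is-just (α′ v))
    onV₁ v = trans (cong (indicator ∘ is-just) (extend-↑ˡ v)) (indicator-target (g v) (α′ v) (disjoint v))

  hits-target-↑ˡ : ∀ a b → (∀ y → a ≡ just y → b ≡ nothing) → ∀ x → hits (target a b) (x ↑ˡ n₂) ≡ hits b x
  hits-target-↑ˡ (just y) b disjoint x rewrite disjoint y refl = ⌊↑ʳ≟↑ˡ⌋ y x
  hits-target-↑ˡ nothing (just z) _ x = ⌊≟⌋-injective (_↑ˡ n₂) (↑ˡ-injective n₂ _ _) z x
  hits-target-↑ˡ nothing nothing _ x = refl

  hits-target-↑ʳ : ∀ a b y → hits (target a b) (n₁ ↑ʳ y) ≡ hits a y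
  hits-target-↑ʳ (just z) b y = ⌊≟⌋-injective (n₁ ↑ʳ_) (↑ʳ-injective n₁ _ _) z y
  hits-target-↑ʳ nothing (just z) y = ⌊↑ˡ≟↑ʳ⌋ z y
  hits-target-↑ʳ nothing nothing y = refl

  monˡ-extend : Disjoint → {m : Mono n₂} → (∀ y → count (λ v → hits (g v) y) ≡ m y)
    → monˡ {n₁} {n₂} extend ≐ embed₂ {n₁} m ⊗ embed₁ {n₁} {n₂} (mon α′)
  monˡ-extend disjoint {m} g-hits = ≐-by-view onV₁ onV₂
    where
    hits-extend : ∀ v w → hits (extend (v ↑ˡ n₂)) w ≡ hits (target (g v) (α′ v)) w
    hits-extend v w = cong (λ z → hits z w) (extend-↑ˡ v)
    onV₁ : ∀ x → monˡ {n₁} {n₂} extend (x ↑ˡ n₂) ≡ embed₂ {n₁} m (x ↑ˡ n₂) + embed₁ {n₁} (mon α′) (x ↑ˡ n₂)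
    onV₁ x = trans (count-cong (λ v → trans (hits-extend v _) (hits-target-↑ˡ (g v) (α′ v) (disjoint v) x)))
                   (sym (cong₂ _+_ (embed₂-↑ˡ {n₁} m x) (embed₁-↑ˡ {n₁} _ x)))
    onV₂ : ∀ y → monˡ {n₁} {n₂} extend (n₁ ↑ʳ y) ≡ embed₂ {n₁} m (n₁ ↑ʳ y) + embed₁ {n₁} (mon α′) (n₁ ↑ʳ y)
    onV₂ y = trans (trans (count-cong (λ v → trans (hits-extend v _) (hits-target-↑ʳ (g v) (α′ v) y))) (g-hits y))
                   (sym (trans (cong₂ _+_ (embed₂-↑ʳ {n₁} m y) (embed₁-↑ʳ {n₁} {n₂} _ y)) (+-identityʳ _)))

free-vertices : ∀ {n} (α′ : PFun n) t → α′ t ≡ nothing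
  → degree α′ + suc (count (λ v → not (is-just (α′ v)) ∧ not ⌊ v ≟ t ⌋)) ≡ n
free-vertices α′ t t-sink = begin
  degree α′ + suc (count (λ v → not (is-just (α′ v)) ∧ not ⌊ v ≟ t ⌋))
    ≡⟨ cong (degree α′ +_) (sym (count-remove (not ∘ is-just ∘ α′) t (cong (not ∘ is-just) t-sink))) ⟩
  degree α′ + count (not ∘ is-just ∘ α′)
    ≡⟨ count+count-not (is-just ∘ α′) ⟩
  _ ∎

budget : ∀ n₂ ℓ d c → n₂ + ℓ + d ≤ ℓ + suc c + n₂ ∸ 1 → d ≤ c
budget n₂ ℓ d c le = +-cancelˡ-≤ (n₂ + ℓ) d c (subst (n₂ + ℓ + d ≤_) capacity le)
  where
  rearrange : ∀ ℓ c n₂ → ℓ + c + n₂ ≡ n₂ + ℓ + c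
  rearrange = solve-∀
  capacity : ℓ + suc c + n₂ ∸ 1 ≡ n₂ + ℓ + c
  capacity = trans (cong (λ x → x + n₂ ∸ 1) (+-suc ℓ c)) (rearrange ℓ c n₂)

centred-extension : ∀ {n₁ n₂} (Γ₁ : Adj n₁) (Γ₂ : Adj n₂) (u : Fin n₁) {k ℓ d}
  → k ≡ n₂ + ℓ + d → k ≤ n₁ + n₂ ∸ 1 → (α′ : PFun n₁) → Nil Γ₁ ℓ α′ → (m : Mono n₂) → mdegree m ≡ d
  → Σ (PFun (n₁ + n₂)) λ α → Nil (join Γ₁ Γ₂) k α × UCentred u k α
      × (mon α ≐ varPow (u ↑ˡ n₂) n₂ ⊗ embed₂ {n₁} m ⊗ embed₁ {n₁} {n₂} (mon α′))
centred-extension {n₁} {n₂} Γ₁ Γ₂ u refl k≤ α′ (animation′ , (M , α′-nil) , refl) m refl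
  with reaches-sink α′ (suc M) u (α′-nil u)
... | j , t , _ , u↦t , t-sink =
  extend ,
  (extend-animation Γ₁ Γ₂ animation′ , extend-nilpotent disjoint {M} {j} α′-nil u↦t t-sink choice-t , degree-k) ,
  V₂↦u⇒centred {n₁} {n₂} {α = extend} (≤-trans (m≤m+n n₂ _) (m≤m+n _ _)) extend-↑ʳ ,
  mon-centred {n₁} {n₂} {extend} extend-↑ʳ (monˡ-extend disjoint hits-choice)
  where
  free : Fin n₁ → Bool
  free v = not (is-just (α′ v)) ∧ not ⌊ v ≟ t ⌋

  enough-free : mdegree m ≤ count free
  enough-free = budget n₂ (degree α′) (mdegree m) (count free)
    (subst (λ n → n₂ + degree α′ + mdegree m ≤ n + n₂ ∸ 1) (sym (free-vertices α′ t t-sink)) k≤)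

  t-not-free : free t ≡ false
  t-not-free = trans (cong (λ b → not (is-just (α′ t)) ∧ not b) (⌊≟⌋-true refl)) (∧-zeroʳ _)

  open Realisation (realise free m enough-free)
  open Extension u α′ choice

  disjoint : Disjoint
  disjoint v y e with α′ v | choice⇒P v y e
  ... | nothing | _ = refl
  ... | just _ | ()

  choice-t : choice t ≡ nothing
  choice-t with choice t in e
  ... | nothing = refl
  ... | just y with () ← trans (sym (choice⇒P t y e)) t-not-free

  degree-k : degree extend ≡ n₂ + degree α′ + mdegree m
  degree-k = trans (degree-extend disjoint)
    (trans (cong (λ c → c + degree α′ + n₂) size-choice) (reverse (mdegree m) (degree α′) n₂))
    where
    reverse : ∀ a b c → a + b + c ≡ c + b + a
    reverse = solve-∀

proposition9p5 : (n₁ n₂ : ℕ) (Γ₁ : Adj n₁) (Γ₂ : Adj n₂) → IsLoopless Γ₁ → IsLoopless Γ₂ → 1 ≤ n₁ → 1 ≤ n₂ → (u : Fin n₁) → (k : ℕ) → n₂ ≤ k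
    → ((α : PFun (n₁ + n₂)) → Nil (join Γ₁ Γ₂) k α → UCentred u k α
        → Nil Γ₁ (degree (restrict₁ {n₁} {n₂} α)) (restrict₁ {n₁} {n₂} α)
          × (mon α ≐ varPow (u ↑ˡ n₂) n₂ ⊗ crossMon {n₁} {n₂} α ⊗ embed₁ {n₁} {n₂} (mon (restrict₁ {n₁} {n₂} α))))
    × ((ℓ d : ℕ) → k ≡ n₂ + ℓ + d → k ≤ n₁ + n₂ ∸ 1 → (α′ : PFun n₁) → Nil Γ₁ ℓ α′ → (m : Mono n₂) → mdegree m ≡ d
        → Σ (PFun (n₁ + n₂)) (λ α → Nil (join Γ₁ Γ₂) k α × UCentred u k α
            × (mon α ≐ varPow (u ↑ˡ n₂) n₂ ⊗ embed₂ {n₁} {n₂} m ⊗ embed₁ {n₁} {n₂} (mon α′))))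
proposition9p5 n₁ n₂ Γ₁ Γ₂ _ _ _ _ u k n₂≤k =
  (λ α α-Nil centred →
    restrict₁-Nil {n₁} {n₂} Γ₁ Γ₂ α α-Nil ,
    mon-centred {n₁} {n₂} {α} (centred⇒V₂↦u {n₁} {n₂} {α = α} n₂≤k centred) (monˡ-restrict₁ {n₁} {n₂} α)) ,
  (λ ℓ d → centred-extension Γ₁ Γ₂ u)
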